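{- For each $(i_{1},i_{2},i_{3})\in\{(1,2,3),(1,3,4)\}$ there are infinitely many triples $(a,b,c)$ of rational numbers with $c\neq 0$ such that the system \[ \sigma_{i_{1}}(P,Q,R,S)=a,\qquad \sigma_{i_{2}}(P,Q,R,S)=b,\qquad \sigma_{i_{3}}(P,Q,R,S)=c \] has infinitely many solutions $(P,Q,R,S)$ in rational numbers.
   Context: For $1\leq i\leq 4$, $\sigma_{i}(x_{1},\ldots,x_{4})=\sum_{1\leq k_{1}<\cdots<k_{i}\leq 4}x_{k_{1}}\cdots x_{k_{i}}$ denotes the $i$-th elementary symmetric polynomial in four variables. -}

module Defs where

open import Data.Nat using (ℕ; zero; suc)
open import Data.Rational using (ℚ; _+_; _*_; 0ℚ; 1ℚ)
open import Data.Product using (Σ; _×_; _,_)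
open import Relation.Binary.PropositionalEquality using (_≡_)
open import Relation.Nullary using (¬_)
open import Function.Definitions using (Injective)

σ : ℕ → ℚ → ℚ → ℚ → ℚ → ℚ
σ 0 p q r s = 1ℚ
σ 1 p q r s = p + q + r + s
σ 2 p q r s = p * q + p * r + p * s + q * r + q * s + r * s
σ 3 p q r s = p * q * r + p * q * s + p * r * s + q * r * s
σ 4 p q r s = p * q * r * s
σ (suc (suc (suc (suc (suc _))))) p q r s = 0ℚ

Infinite : {A : Set} → (A → Set) → Set
Infinite {A} P = Σ (ℕ → A) λ f → Injective _≡_ _≡_ f × (∀ n → P (f n))

Quad : Set
Quad = ℚ × ℚ × ℚ × ℚ

Triple : Set
Triple = ℚ × ℚ × ℚ

Solves : ℕ → ℕ → ℕ → Triple → Quad → Set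
Solves i₁ i₂ i₃ (a , b , c) (p , q , r , s) =
  (σ i₁ p q r s ≡ a) × (σ i₂ p q r s ≡ b) × (σ i₃ p q r s ≡ c)

Good : ℕ → ℕ → ℕ → Triple → Set
Good i₁ i₂ i₃ (a , b , c) = (¬ (c ≡ 0ℚ)) × Infinite (Solves i₁ i₂ i₃ (a , b , c))

{-# OPTIONS --safe #-}
-- Each σᵢ is homogeneous of degree i, so multiplying a solution by l > 0 turns a
-- good triple (a, b, c) into the good triple (lⁱ¹ a, lⁱ² b, lⁱ³ c); as c ≠ 0 and
-- i₃ ≥ 1 these are pairwise distinct, so one good triple per system suffices.
-- With D = 1 + t², the quadruple (2, 2t², (1+t)², (1-t)²) has σ₁ = 4D, σ₂ = 5D²,
-- σ₃ = 2D³, so dividing it by D solves σ₁ = 4, σ₂ = 5, σ₃ = 2 for every t; and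
-- (D, -D, 1/D, -1/D) solves σ₁ = 0, σ₃ = 0, σ₄ = 1.
module Submission where

open import Defs
open import Data.Nat as ℕ using (ℕ; zero; suc)
import Data.Nat.Properties as ℕ
import Data.Integer.Properties as ℤ
open import Data.Integer using (+_)
open import Data.Rational
  using (ℚ; _/_; ↥_; _+_; _*_; -_; _-_; 0ℚ; 1ℚ; _<_; 1/_; Positive; NonNegative; NonZero;
         positive; negative; ≢-nonZero)
open import Data.Rational.Literals using (fromℤ)
open import Data.Rational.Properties
open import Data.Rational.Solver using (module +-*-Solver)
open import Algebra.Bundles using (CommutativeRing)
open import Algebra.Properties.Semiring.Exp (CommutativeRing.semiring +-*-commutativeRing) using (_^_)
open import Algebra.Properties.Group +-0-group using (∙-cancelˡ)
open import Data.Product using (_×_; _,_; proj₁; proj₂)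
open import Function.Base using (_∘_)
open import Function.Definitions using (Injective)
open import Relation.Binary.Definitions using (tri<; tri≈; tri>)
open import Relation.Binary.PropositionalEquality
open import Relation.Nullary using (¬_; contradiction)

Infinite-map : {A B : Set} {P : A → Set} {Q : B → Set} (g : A → B) →
               (∀ {x y} → P x → P y → g x ≡ g y → x ≡ y) →
               (∀ x → P x → Q (g x)) →
               Infinite P → Infinite Q
Infinite-map g g-injective g-preserves (f , f-injective , P-f) =
  g ∘ f , (λ eq → f-injective (g-injective (P-f _) (P-f _) eq)) ,
  λ n → g-preserves (f n) (P-f n)

Positive-infinite : Infinite Positive
Positive-infinite = (λ k → fromℤ (+ suc k)) , injective , λ _ → _
  where
  injective : Injective _≡_ _≡_ (λ k → fromℤ (+ suc k))
  injective eq = ℕ.suc-injective (ℤ.+-injective (cong ↥_ eq))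

*-cancelˡ-≡ : ∀ x .{{_ : NonZero x}} {p q} → x * p ≡ x * q → p ≡ q
*-cancelˡ-≡ x {p} {q} eq = trans (sym (undo p)) (trans (cong (1/ x *_) eq) (undo q))
  where
  undo : ∀ r → 1/ x * (x * r) ≡ r
  undo r = trans (sym (*-assoc (1/ x) x r)) (trans (cong (_* r) (*-inverseˡ x)) (*-identityˡ r))

*-cancelʳ-≡ : ∀ x .{{_ : NonZero x}} {p q} → p * x ≡ q * x → p ≡ q
*-cancelʳ-≡ x {p} {q} eq = *-cancelˡ-≡ x (trans (*-comm x p) (trans eq (*-comm q x)))

1/-injective : ∀ {p q} .{{_ : NonZero p}} .{{_ : NonZero q}} → 1/ p ≡ 1/ q → p ≡ q
1/-injective {p} {q} eq = *-cancelˡ-≡ (1/ q) {{nonZero⇒1/nonZero q}} (begin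
  1/ q * p  ≡⟨ cong (_* p) (sym eq) ⟩
  1/ p * p  ≡⟨ *-inverseˡ p ⟩
  1ℚ        ≡⟨ sym (*-inverseˡ q) ⟩
  1/ q * q  ∎)
  where open ≡-Reasoning

pos⇒pos^ : ∀ x .{{_ : Positive x}} n → Positive (x ^ n)
pos⇒pos^ x zero    = _
pos⇒pos^ x (suc n) = pos*pos⇒pos x (x ^ n) {{pos⇒pos^ x n}}

^-monoˡ-<-pos : ∀ n {x y} .{{_ : Positive x}} → x < y → x ^ suc n < y ^ suc n
^-monoˡ-<-pos zero    x<y = *-monoˡ-<-pos 1ℚ x<y
^-monoˡ-<-pos (suc n) {x} {y} x<y =
  <-trans (*-monoʳ-<-pos x (^-monoˡ-<-pos n x<y))
          (*-monoˡ-<-pos (y ^ suc n) {{pos⇒pos^ y {{y>0}} (suc n)}} x<y)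
  where
  y>0 : Positive y
  y>0 = positive (<-trans (positive⁻¹ x) x<y)

^-injectiveˡ-pos : ∀ n {x y} .{{_ : Positive x}} .{{_ : Positive y}} →
                   x ^ suc n ≡ y ^ suc n → x ≡ y
^-injectiveˡ-pos n {x} {y} eq with <-cmp x y
... | tri< x<y _   _   = contradiction eq (<⇒≢ (^-monoˡ-<-pos n x<y))
... | tri≈ _   x≡y _   = x≡y
... | tri> _   _   y<x = contradiction (sym eq) (<⇒≢ (^-monoˡ-<-pos n y<x))

open +-*-Solver using (Polynomial; con; _:+_; _:*_; _:^_; :-_; _:-_; _:=_; solve)

-- σ in the solver's expression language: ⟦ σ-expr i … ⟧ unfolds to σ i ⟦ … ⟧ for each numeral i.
σ-expr : ∀ {m} → ℕ → (p q r s : Polynomial m) → Polynomial m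
σ-expr 0 p q r s = con 1ℚ
σ-expr 1 p q r s = p :+ q :+ r :+ s
σ-expr 2 p q r s = p :* q :+ p :* r :+ p :* s :+ q :* r :+ q :* s :+ r :* s
σ-expr 3 p q r s = p :* q :* r :+ p :* q :* s :+ p :* r :* s :+ q :* r :* s
σ-expr 4 p q r s = p :* q :* r :* s
σ-expr (suc (suc (suc (suc (suc _))))) p q r s = con 0ℚ

σ-homogeneity-identity : ℕ → (l p q r s : Polynomial 5) → Polynomial 5 × Polynomial 5
σ-homogeneity-identity i l p q r s =
  σ-expr i (l :* p) (l :* q) (l :* r) (l :* s) := l :^ i :* σ-expr i p q r s

σ-homogeneous : ∀ i l p q r s → σ i (l * p) (l * q) (l * r) (l * s) ≡ l ^ i * σ i p q r s
σ-homogeneous 0 = solve 5 (σ-homogeneity-identity 0) refl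
σ-homogeneous 1 = solve 5 (σ-homogeneity-identity 1) refl
σ-homogeneous 2 = solve 5 (σ-homogeneity-identity 2) refl
σ-homogeneous 3 = solve 5 (σ-homogeneity-identity 3) refl
σ-homogeneous 4 = solve 5 (σ-homogeneity-identity 4) refl
σ-homogeneous i@(suc (suc (suc (suc (suc _))))) l p q r s = sym (*-zeroʳ (l ^ i))

scaleQuad : ℚ → Quad → Quad
scaleQuad l (p , q , r , s) = l * p , l * q , l * r , l * s

scaleQuad-injective : ∀ l .{{_ : NonZero l}} → Injective _≡_ _≡_ (scaleQuad l)
scaleQuad-injective l eq
  with refl ← *-cancelˡ-≡ l (cong proj₁ eq)
     | refl ← *-cancelˡ-≡ l (cong (proj₁ ∘ proj₂) eq)
     | refl ← *-cancelˡ-≡ l (cong (proj₁ ∘ proj₂ ∘ proj₂) eq)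
     | refl ← *-cancelˡ-≡ l (cong (proj₂ ∘ proj₂ ∘ proj₂) eq)
  = refl

module Scaling (i₁ i₂ i₃ : ℕ) where

  scaleTriple : ℚ → Triple → Triple
  scaleTriple l (a , b , c) = l ^ i₁ * a , l ^ i₂ * b , l ^ i₃ * c

  Solves-scale : ∀ l t {x} → Solves i₁ i₂ i₃ t x → Solves i₁ i₂ i₃ (scaleTriple l t) (scaleQuad l x)
  Solves-scale l (_ , _ , _) {p , q , r , s} (eq₁ , eq₂ , eq₃) =
    scaled i₁ eq₁ , scaled i₂ eq₂ , scaled i₃ eq₃
    where
    scaled : ∀ i {e} → σ i p q r s ≡ e → σ i (l * p) (l * q) (l * r) (l * s) ≡ l ^ i * e
    scaled i eq = trans (σ-homogeneous i l p q r s) (cong (l ^ i *_) eq)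

  Good-scale : ∀ l .{{_ : Positive l}} t → Good i₁ i₂ i₃ t → Good i₁ i₂ i₃ (scaleTriple l t)
  Good-scale l t@(_ , _ , c) (c≢0 , solutions) =
    scaled-c≢0 ,
    Infinite-map {Q = Solves i₁ i₂ i₃ (scaleTriple l t)} (scaleQuad l)
                 (λ _ _ → scaleQuad-injective l {{pos⇒nonZero l}})
                 (λ x → Solves-scale l t {x}) solutions
    where
    instance
      lⁱ≢0 : NonZero (l ^ i₃)
      lⁱ≢0 = pos⇒nonZero (l ^ i₃) {{pos⇒pos^ l i₃}}
    scaled-c≢0 : ¬ l ^ i₃ * c ≡ 0ℚ
    scaled-c≢0 eq = c≢0 (*-cancelˡ-≡ (l ^ i₃) (trans eq (sym (*-zeroʳ (l ^ i₃)))))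

Good⇒Infinite-Good : ∀ i₁ i₂ i₃ → 0 ℕ.< i₃ → ∀ t → Good i₁ i₂ i₃ t → Infinite (Good i₁ i₂ i₃)
Good⇒Infinite-Good i₁ i₂ (suc i₃) ℕ.z<s t@(_ , _ , c) good@(c≢0 , _) =
  Infinite-map {Q = Good i₁ i₂ (suc i₃)} (λ l → scaleTriple l t) injective
               (λ l l>0 → Good-scale l {{l>0}} t good) Positive-infinite
  where
  open Scaling i₁ i₂ (suc i₃)
  instance
    c-nonZero : NonZero c
    c-nonZero = ≢-nonZero c≢0
  injective : ∀ {l m} → Positive l → Positive m → scaleTriple l t ≡ scaleTriple m t → l ≡ m
  injective l>0 m>0 eq =
    ^-injectiveˡ-pos i₃ {{l>0}} {{m>0}} (*-cancelʳ-≡ c (cong (proj₂ ∘ proj₂) eq))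

square-nonNeg : ∀ t → NonNegative (t ^ 2)
square-nonNeg t with <-cmp t 0ℚ
... | tri< t<0 _ _ = subst NonNegative (cong (t *_) (sym (*-identityʳ t)))
                       (pos⇒nonNeg (t * t) {{neg*neg⇒pos t {{t<0′}} t {{t<0′}}}})
  where t<0′ = negative t<0
... | tri≈ _ refl _ = _
... | tri> _ _ t>0 = pos⇒nonNeg (t ^ 2) {{pos⇒pos^ t {{positive t>0}} 2}}

1+sq : ℚ → ℚ
1+sq t = 1ℚ + t ^ 2

1+sq-nonZero : ∀ t → NonZero (1+sq t)
1+sq-nonZero t = pos⇒nonZero (1+sq t) {{pos+nonNeg⇒pos 1ℚ (t ^ 2) {{square-nonNeg t}}}}

1+sq⁻¹ : ℚ → ℚ
1+sq⁻¹ t = (1/ (1+sq t)) {{1+sq-nonZero t}}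

1+sq*1+sq⁻¹ : ∀ t → 1+sq t * 1+sq⁻¹ t ≡ 1ℚ
1+sq*1+sq⁻¹ t = *-inverseʳ (1+sq t) {{1+sq-nonZero t}}

1+sq-injective : ∀ {s t} → Positive s → Positive t → 1+sq s ≡ 1+sq t → s ≡ t
1+sq-injective s>0 t>0 eq = ^-injectiveˡ-pos 1 {{s>0}} {{t>0}} (∙-cancelˡ 1ℚ _ _ eq)

1+sq⁻¹-injective : ∀ {s t} → Positive s → Positive t → 1+sq⁻¹ s ≡ 1+sq⁻¹ t → s ≡ t
1+sq⁻¹-injective {s} {t} s>0 t>0 eq =
  1+sq-injective s>0 t>0 (1/-injective {{1+sq-nonZero s}} {{1+sq-nonZero t}} eq)

-- For numerals k and i the right-hand side k * 1ℚ ^ i computes to k.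
substitute-1+sq*1+sq⁻¹ : ∀ t {x} k i → x ≡ k * (1+sq t * 1+sq⁻¹ t) ^ i → x ≡ k * 1ℚ ^ i
substitute-1+sq*1+sq⁻¹ t k i eq = trans eq (cong (λ u → k * u ^ i) (1+sq*1+sq⁻¹ t))

roots₁₂₃ : ℚ → Quad
roots₁₂₃ t = + 2 / 1 * w , + 2 / 1 * t ^ 2 * w , (1ℚ + t) ^ 2 * w , (1ℚ - t) ^ 2 * w
  where w = 1+sq⁻¹ t

roots₁₂₃-identity : ℕ → ℚ → (t w : Polynomial 2) → Polynomial 2 × Polynomial 2
roots₁₂₃-identity i k t w =
  σ-expr i (two :* w) (two :* t :^ 2 :* w) ((con 1ℚ :+ t) :^ 2 :* w) ((con 1ℚ :- t) :^ 2 :* w)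
    := con k :* ((con 1ℚ :+ t :^ 2) :* w) :^ i
  where two = con (+ 2 / 1)

roots₁₂₃-solves : ∀ t → Solves 1 2 3 (+ 4 / 1 , + 5 / 1 , + 2 / 1) (roots₁₂₃ t)
roots₁₂₃-solves t =
  substitute-1+sq*1+sq⁻¹ t (+ 4 / 1) 1 (solve 2 (roots₁₂₃-identity 1 (+ 4 / 1)) refl t w) ,
  substitute-1+sq*1+sq⁻¹ t (+ 5 / 1) 2 (solve 2 (roots₁₂₃-identity 2 (+ 5 / 1)) refl t w) ,
  substitute-1+sq*1+sq⁻¹ t (+ 2 / 1) 3 (solve 2 (roots₁₂₃-identity 3 (+ 2 / 1)) refl t w)
  where w = 1+sq⁻¹ t

roots₁₃₄ : ℚ → Quad
roots₁₃₄ t = 1+sq t , - 1+sq t , 1+sq⁻¹ t , - 1+sq⁻¹ t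

roots₁₃₄-solves : ∀ t → Solves 1 3 4 (0ℚ , 0ℚ , 1ℚ) (roots₁₃₄ t)
roots₁₃₄-solves t =
  solve 2 (λ d w → σ-pairs 1 d w := con 0ℚ) refl (1+sq t) w ,
  solve 2 (λ d w → σ-pairs 3 d w := con 0ℚ) refl (1+sq t) w ,
  substitute-1+sq*1+sq⁻¹ t 1ℚ 2
    (solve 2 (λ d w → σ-pairs 4 d w := con 1ℚ :* (d :* w) :^ 2) refl (1+sq t) w)
  where
  w = 1+sq⁻¹ t
  σ-pairs : ℕ → (d w : Polynomial 2) → Polynomial 2
  σ-pairs i d w = σ-expr i d (:- d) w (:- w)

good₁₂₃ : Good 1 2 3 (+ 4 / 1 , + 5 / 1 , + 2 / 1)
good₁₂₃ = (λ ()) , Infinite-map {Q = Solves 1 2 3 (+ 4 / 1 , + 5 / 1 , + 2 / 1)} roots₁₂₃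
  (λ s>0 t>0 eq → 1+sq⁻¹-injective s>0 t>0 (*-cancelˡ-≡ (+ 2 / 1) (cong proj₁ eq)))
  (λ t _ → roots₁₂₃-solves t) Positive-infinite

good₁₃₄ : Good 1 3 4 (0ℚ , 0ℚ , 1ℚ)
good₁₃₄ = (λ ()) , Infinite-map {Q = Solves 1 3 4 (0ℚ , 0ℚ , 1ℚ)} roots₁₃₄
  (λ s>0 t>0 eq → 1+sq-injective s>0 t>0 (cong proj₁ eq))
  (λ t _ → roots₁₃₄-solves t) Positive-infinite

theorem4 : Infinite (Good 1 2 3) × Infinite (Good 1 3 4)
theorem4 = Good⇒Infinite-Good 1 2 3 ℕ.z<s _ good₁₂₃ , Good⇒Infinite-Good 1 3 4 ℕ.z<s _ good₁₃₄
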